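{- For integers $n\ge 0$ and $m$, let $A^{H}(n,m)$ denote the number of vertically constrained $S_{MW}$ paths (no restriction on height, first step arbitrary) from $(0,0)$ to $(n,m)$. Then $A^{H}(0,m)=1$ if $m\in\{ -1,0,1\}$ and $A^{H}(0,m)=0$ otherwise, and for all $n\ge 1$ and all $m\in\mathbb{Z}$, $$A^{H}(n,m)=A^{H}(n-1,m+2)+2A^{H}(n-1,m+1)+3A^{H}(n-1,m)+2A^{H}(n-1,m-1)+A^{H}(n-1,m-2).$$
   Context: A lattice path is a finite sequence of steps (vectors in $\mathbb{Z}^2$) starting at $(0,0)$; its vertices are the partial sums, and it terminates at the last vertex (the empty path terminates at $(0,0)$). Let $S_{M}=\{(1,0),(1,1),(1,-1)\}$ and $S_{MW}=S_M\cup\{(0,1),(0,-1)\}$; the steps $(0,1),(0,-1)$ are called vertical. A vertically constrained $S_{MW}$ path is a lattice path with steps in $S_{MW}$ in which no two consecutive steps are both vertical. -}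

module Defs where

open import Data.Nat using (ℕ; zero; suc)
open import Data.Integer using (ℤ; +_; -[1+_]; _+_)
open import Data.List using (List; []; _∷_)
open import Data.Product using (Σ; _×_; _,_)
open import Data.Fin using (Fin)
open import Data.Unit using (⊤)
open import Data.Empty using (⊥)
open import Relation.Binary.PropositionalEquality using (_≡_)
open import Function.Bundles using (_↔_)

data Step : Set where
  E NE SE N S : Step

dx : Step → ℤ
dx E  = + 1
dx NE = + 1
dx SE = + 1
dx N  = + 0
dx S  = + 0

dy : Step → ℤ
dy E  = + 0
dy NE = + 1
dy SE = -[1+ 0 ]
dy N  = + 1
dy S  = -[1+ 0 ]

Vertical : Step → Set
Vertical N = ⊤
Vertical S = ⊤
Vertical _ = ⊥

Path : Set
Path = List Step

endX : Path → ℤ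
endX []       = + 0
endX (s ∷ p)  = dx s + endX p

endY : Path → ℤ
endY []       = + 0
endY (s ∷ p)  = dy s + endY p

data VertConstrained : Path → Set where
  vc-nil  : VertConstrained []
  vc-one  : ∀ s → VertConstrained (s ∷ [])
  vc-cons : ∀ s t p → (Vertical s → Vertical t → ⊥) →
            VertConstrained (t ∷ p) → VertConstrained (s ∷ t ∷ p)

PathsTo : ℤ → ℤ → Set
PathsTo x y = Σ Path λ p → VertConstrained p × (endX p ≡ x) × (endY p ≡ y)

HasCard : Set → ℕ → Set
HasCard P k = P ↔ Fin k

{-# OPTIONS --safe #-}
module Submission where

-- A vertically constrained path is either a lone riser (empty, or one vertical step), or a
-- riser followed by a horizontal step and then an arbitrary vertically constrained path.
-- Riser and horizontal step each shift the height by -1, 0 or +1 independently, so a path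
-- to (n+1, m) amounts to a pair of shifts (v, h) together with a path to (n, m - v - h).
-- Among the nine pairs the total shift is ±2 once, ±1 twice and 0 three times.

open import Defs
open import Data.Nat using (ℕ; zero; suc; _+_; _*_)
open import Data.Integer using (ℤ; +_; -[1+_]) renaming (_+_ to _+ℤ_; _-_ to _-ℤ_)
open import Data.Product using (Σ; _×_; _,_)
open import Data.Empty using (⊥)
open import Relation.Binary.PropositionalEquality using (_≡_)

open import Axiom.UniquenessOfIdentityProofs using (module Decidable⇒UIP)
open import Data.Bool using (if_then_else_)
open import Data.Empty using (⊥-elim)
import Data.Fin as Fin
open import Data.Fin.Properties using (+↔⊎)
open import Data.Integer using (_≟_)
open import Data.Integer.Properties using (+-assoc; +-comm; +-identityˡ; +-identityʳ; +-0-abelianGroup)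
open import Algebra.Properties.AbelianGroup +-0-abelianGroup using (//-rightDividesˡ; //-rightDividesʳ)
open import Data.List using ([]; _∷_; _++_)
open import Data.Nat.Tactic.RingSolver using (solve-∀)
open import Data.Product using (∃; proj₁)
open import Data.Sum using (_⊎_; inj₁; inj₂)
open import Data.Sum.Function.Propositional using (_⊎-cong_)
open import Function.Base using (_∘_)
open import Function.Bundles using (_↔_; mk↔ₛ′)
open import Function.Properties.Inverse using (↔-sym; ↔-trans)
open import Relation.Nullary using (Dec; yes; no; does; ¬_; Irrelevant)
open import Relation.Nullary.Decidable using (dec-false)
open import Relation.Binary.PropositionalEquality using (refl; sym; trans; cong; cong₂; _≢_; module ≡-Reasoning)

ℤ-≡-irrelevant : {x y : ℤ} → Irrelevant (x ≡ y)
ℤ-≡-irrelevant = Decidable⇒UIP.≡-irrelevant _≟_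

+-transposeˡ : ∀ a y m → a +ℤ y ≡ m → y ≡ m -ℤ a
+-transposeˡ a y m refl = sym (trans (cong (_-ℤ a) (+-comm a y)) (//-rightDividesʳ a y))

+-transposeˡ⁻ : ∀ a y m → y ≡ m -ℤ a → a +ℤ y ≡ m
+-transposeˡ⁻ a y m refl = trans (+-comm a (m -ℤ a)) (//-rightDividesˡ a m)

-- A direction is read both as an optional vertical step (riser) and as a horizontal step,
-- through its effect on the height.
data Dir : Set where
  down level up : Dir

⟦_⟧ : Dir → ℤ
⟦ down ⟧  = -[1+ 0 ]
⟦ level ⟧ = + 0
⟦ up ⟧    = + 1

horizontal : Dir → Step
horizontal down  = SE
horizontal level = E
horizontal up    = NE

riser : Dir → Path
riser down  = S ∷ []
riser level = []
riser up    = N ∷ []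

lead : Dir → Dir → Path → Path
lead v h q = riser v ++ horizontal h ∷ q

-- The function fields of vc-cons land in ⊥, which the standard library defines as a record
-- with an irrelevant field, so any two of them are definitionally equal.
VertConstrained-irrelevant : ∀ {p} → Irrelevant (VertConstrained p)
VertConstrained-irrelevant vc-nil vc-nil = refl
VertConstrained-irrelevant (vc-one s) (vc-one s) = refl
VertConstrained-irrelevant (vc-cons s t p f vc) (vc-cons s t p _ vc′) =
  cong (vc-cons s t p f) (VertConstrained-irrelevant vc vc′)

PathsTo-≡ : ∀ {x y} {a b : PathsTo x y} → proj₁ a ≡ proj₁ b → a ≡ b
PathsTo-≡ {a = p , vc , ex , ey} {p , vc′ , ex′ , ey′} refl
  rewrite VertConstrained-irrelevant vc vc′ | ℤ-≡-irrelevant ex ex′ | ℤ-≡-irrelevant ey ey′ = refl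

VertConstrained-∷ : ∀ {s q} → ¬ Vertical s → VertConstrained q → VertConstrained (s ∷ q)
VertConstrained-∷ {s} ¬vs vc-nil = vc-one s
VertConstrained-∷ {s} ¬vs (vc-one t) = vc-cons s t [] (λ vs _ → ¬vs vs) (vc-one t)
VertConstrained-∷ {s} ¬vs (vc-cons t u p f vc) =
  vc-cons s t (u ∷ p) (λ vs _ → ¬vs vs) (vc-cons t u p f vc)

VertConstrained-tail : ∀ {s q} → VertConstrained (s ∷ q) → VertConstrained q
VertConstrained-tail (vc-one _) = vc-nil
VertConstrained-tail (vc-cons _ _ _ _ vc) = vc

horizontal-not-vertical : ∀ h → ¬ Vertical (horizontal h)
horizontal-not-vertical down  = λ x → x
horizontal-not-vertical level = λ x → x
horizontal-not-vertical up    = λ x → x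

VertConstrained-riser : ∀ v → VertConstrained (riser v)
VertConstrained-riser down  = vc-one S
VertConstrained-riser level = vc-nil
VertConstrained-riser up    = vc-one N

VertConstrained-lead : ∀ v h {q} → VertConstrained q → VertConstrained (lead v h q)
VertConstrained-lead down h vc =
  vc-cons S _ _ (λ _ → horizontal-not-vertical h) (VertConstrained-∷ (horizontal-not-vertical h) vc)
VertConstrained-lead level h vc = VertConstrained-∷ (horizontal-not-vertical h) vc
VertConstrained-lead up h vc =
  vc-cons N _ _ (λ _ → horizontal-not-vertical h) (VertConstrained-∷ (horizontal-not-vertical h) vc)

VertConstrained-lead⁻ : ∀ v h {q} → VertConstrained (lead v h q) → VertConstrained q
VertConstrained-lead⁻ down  h = VertConstrained-tail ∘ VertConstrained-tail
VertConstrained-lead⁻ level h = VertConstrained-tail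
VertConstrained-lead⁻ up    h = VertConstrained-tail ∘ VertConstrained-tail

endX-++ : ∀ p q → endX (p ++ q) ≡ endX p +ℤ endX q
endX-++ [] q = sym (+-identityˡ (endX q))
endX-++ (s ∷ p) q = trans (cong (dx s +ℤ_) (endX-++ p q)) (sym (+-assoc (dx s) (endX p) (endX q)))

endY-++ : ∀ p q → endY (p ++ q) ≡ endY p +ℤ endY q
endY-++ [] q = sym (+-identityˡ (endY q))
endY-++ (s ∷ p) q = trans (cong (dy s +ℤ_) (endY-++ p q)) (sym (+-assoc (dy s) (endY p) (endY q)))

dx-natural : ∀ s → ∃ λ j → dx s ≡ + j
dx-natural E  = 1 , refl
dx-natural NE = 1 , refl
dx-natural SE = 1 , refl
dx-natural N  = 0 , refl
dx-natural S  = 0 , refl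

endX-natural : ∀ p → ∃ λ k → endX p ≡ + k
endX-natural [] = 0 , refl
endX-natural (s ∷ p) with dx-natural s | endX-natural p
... | j , ej | k , ek = j + k , cong₂ _+ℤ_ ej ek

endX-riser : ∀ v → endX (riser v) ≡ + 0
endX-riser down  = refl
endX-riser level = refl
endX-riser up    = refl

endY-riser : ∀ v → endY (riser v) ≡ ⟦ v ⟧
endY-riser down  = refl
endY-riser level = refl
endY-riser up    = refl

dx-horizontal : ∀ h → dx (horizontal h) ≡ + 1
dx-horizontal down  = refl
dx-horizontal level = refl
dx-horizontal up    = refl

dy-horizontal : ∀ h → dy (horizontal h) ≡ ⟦ h ⟧
dy-horizontal down  = refl
dy-horizontal level = refl
dy-horizontal up    = refl

endX-lead : ∀ v h q → endX (lead v h q) ≡ + 1 +ℤ endX q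
endX-lead v h q = begin
  endX (riser v ++ horizontal h ∷ q)
    ≡⟨ endX-++ (riser v) (horizontal h ∷ q) ⟩
  endX (riser v) +ℤ (dx (horizontal h) +ℤ endX q)
    ≡⟨ cong₂ _+ℤ_ (endX-riser v) (cong (_+ℤ endX q) (dx-horizontal h)) ⟩
  + 0 +ℤ (+ 1 +ℤ endX q)
    ≡⟨ +-identityˡ _ ⟩
  + 1 +ℤ endX q
    ∎
  where open ≡-Reasoning

endY-lead : ∀ v h q → endY (lead v h q) ≡ (⟦ v ⟧ +ℤ ⟦ h ⟧) +ℤ endY q
endY-lead v h q = begin
  endY (riser v ++ horizontal h ∷ q)
    ≡⟨ endY-++ (riser v) (horizontal h ∷ q) ⟩
  endY (riser v) +ℤ (dy (horizontal h) +ℤ endY q)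
    ≡⟨ cong₂ _+ℤ_ (endY-riser v) (cong (_+ℤ endY q) (dy-horizontal h)) ⟩
  ⟦ v ⟧ +ℤ (⟦ h ⟧ +ℤ endY q)
    ≡⟨ +-assoc ⟦ v ⟧ ⟦ h ⟧ (endY q) ⟨
  (⟦ v ⟧ +ℤ ⟦ h ⟧) +ℤ endY q
    ∎
  where open ≡-Reasoning

endX-lead-≢0 : ∀ v h q → endX (lead v h q) ≢ + 0
endX-lead-≢0 v h q eq with k , e ← endX-natural q
  with () ← trans (sym (trans (endX-lead v h q) (cong (+ 1 +ℤ_) e))) eq

data Shape : Path → Set where
  riser-shape : ∀ v → Shape (riser v)
  lead-shape  : ∀ v h q → Shape (lead v h q)

double-vertical : ∀ {s t q} → VertConstrained (s ∷ t ∷ q) → Vertical s → ¬ Vertical t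
double-vertical (vc-cons _ _ _ f _) = f

shape : ∀ p → VertConstrained p → Shape p
shape []            _  = riser-shape level
shape (N ∷ [])      _  = riser-shape up
shape (S ∷ [])      _  = riser-shape down
shape (E ∷ q)       _  = lead-shape level level q
shape (NE ∷ q)      _  = lead-shape level up q
shape (SE ∷ q)      _  = lead-shape level down q
shape (N ∷ E ∷ q)   _  = lead-shape up level q
shape (N ∷ NE ∷ q)  _  = lead-shape up up q
shape (N ∷ SE ∷ q)  _  = lead-shape up down q
shape (S ∷ E ∷ q)   _  = lead-shape down level q
shape (S ∷ NE ∷ q)  _  = lead-shape down up q
shape (S ∷ SE ∷ q)  _  = lead-shape down down q
shape (N ∷ N ∷ q)   vc = ⊥-elim (double-vertical vc _ _)
shape (N ∷ S ∷ q)   vc = ⊥-elim (double-vertical vc _ _)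
shape (S ∷ N ∷ q)   vc = ⊥-elim (double-vertical vc _ _)
shape (S ∷ S ∷ q)   vc = ⊥-elim (double-vertical vc _ _)

shape-riser : ∀ v (vc : VertConstrained (riser v)) → shape (riser v) vc ≡ riser-shape v
shape-riser down  _ = refl
shape-riser level _ = refl
shape-riser up    _ = refl

shape-lead : ∀ v h q (vc : VertConstrained (lead v h q)) → shape (lead v h q) vc ≡ lead-shape v h q
shape-lead down  down  _ _ = refl
shape-lead down  level _ _ = refl
shape-lead down  up    _ _ = refl
shape-lead level down  _ _ = refl
shape-lead level level _ _ = refl
shape-lead level up    _ _ = refl
shape-lead up    down  _ _ = refl
shape-lead up    level _ _ = refl
shape-lead up    up    _ _ = refl

module _ (m : ℤ) where

  splitRiser : ∀ {p} → Shape p → endX p ≡ + 0 → endY p ≡ m → Σ Dir λ v → ⟦ v ⟧ ≡ m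
  splitRiser (riser-shape v)    _  ey = v , trans (sym (endY-riser v)) ey
  splitRiser (lead-shape v h q) ex _  = ⊥-elim (endX-lead-≢0 v h q ex)

  joinRiser : (Σ Dir λ v → ⟦ v ⟧ ≡ m) → PathsTo (+ 0) m
  joinRiser (v , e) = riser v , VertConstrained-riser v , endX-riser v , trans (endY-riser v) e

  splitRiser-shape-riser : ∀ v vc ex ey →
    splitRiser (shape (riser v) vc) ex ey ≡ splitRiser (riser-shape v) ex ey
  splitRiser-shape-riser v vc ex ey = cong (λ w → splitRiser w ex ey) (shape-riser v vc)

  PathsTo-zero-↔ : PathsTo (+ 0) m ↔ (Σ Dir λ v → ⟦ v ⟧ ≡ m)
  PathsTo-zero-↔ = mk↔ₛ′ to joinRiser to-from from-to
    where
    to : PathsTo (+ 0) m → Σ Dir λ v → ⟦ v ⟧ ≡ m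
    to (p , vc , ex , ey) = splitRiser (shape p vc) ex ey

    to-from : ∀ y → to (joinRiser y) ≡ y
    to-from (v , e) = trans (splitRiser-shape-riser v _ _ _) (cong (v ,_) (ℤ-≡-irrelevant _ _))

    joinRiser-splitRiser : ∀ {p} (w : Shape p) ex ey → proj₁ (joinRiser (splitRiser w ex ey)) ≡ p
    joinRiser-splitRiser (riser-shape v)    _  _ = refl
    joinRiser-splitRiser (lead-shape v h q) ex _ = ⊥-elim (endX-lead-≢0 v h q ex)

    from-to : ∀ x → joinRiser (to x) ≡ x
    from-to (p , vc , ex , ey) = PathsTo-≡ (joinRiser-splitRiser (shape p vc) ex ey)

module _ (n : ℕ) (m : ℤ) where

  Rest : Dir → Dir → Set
  Rest v h = PathsTo (+ n) (m -ℤ (⟦ v ⟧ +ℤ ⟦ h ⟧))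

  splitLead : ∀ {p} → Shape p → VertConstrained p → endX p ≡ + suc n → endY p ≡ m →
              Σ Dir λ v → Σ Dir (Rest v)
  splitLead (riser-shape v) _ ex _ with () ← trans (sym (endX-riser v)) ex
  splitLead (lead-shape v h q) vc ex ey =
    v , h , q , VertConstrained-lead⁻ v h vc ,
    -- + suc n -ℤ + 1 reduces to + n
    +-transposeˡ (+ 1) (endX q) (+ suc n) (trans (sym (endX-lead v h q)) ex) ,
    +-transposeˡ (⟦ v ⟧ +ℤ ⟦ h ⟧) (endY q) m (trans (sym (endY-lead v h q)) ey)

  joinLead : (Σ Dir λ v → Σ Dir (Rest v)) → PathsTo (+ suc n) m
  joinLead (v , h , q , vc , ex , ey) =
    lead v h q , VertConstrained-lead v h vc ,
    trans (endX-lead v h q) (+-transposeˡ⁻ (+ 1) (endX q) (+ suc n) ex) ,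
    trans (endY-lead v h q) (+-transposeˡ⁻ (⟦ v ⟧ +ℤ ⟦ h ⟧) (endY q) m ey)

  splitLead-shape-lead : ∀ v h q vc ex ey →
    splitLead (shape (lead v h q) vc) vc ex ey ≡ splitLead (lead-shape v h q) vc ex ey
  splitLead-shape-lead v h q vc ex ey = cong (λ w → splitLead w vc ex ey) (shape-lead v h q vc)

  PathsTo-suc-↔ : PathsTo (+ suc n) m ↔ (Σ Dir λ v → Σ Dir (Rest v))
  PathsTo-suc-↔ = mk↔ₛ′ to joinLead to-from from-to
    where
    to : PathsTo (+ suc n) m → Σ Dir λ v → Σ Dir (Rest v)
    to (p , vc , ex , ey) = splitLead (shape p vc) vc ex ey

    to-from : ∀ y → to (joinLead y) ≡ y
    to-from (v , h , q , _) = trans (splitLead-shape-lead v h q _ _ _) (cong (λ r → v , h , r) (PathsTo-≡ refl))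

    joinLead-splitLead : ∀ {p} (w : Shape p) vc ex ey → proj₁ (joinLead (splitLead w vc ex ey)) ≡ p
    joinLead-splitLead (riser-shape v) _ ex _ with () ← trans (sym (endX-riser v)) ex
    joinLead-splitLead (lead-shape v h q) _ _ _ = refl

    from-to : ∀ x → joinLead (to x) ≡ x
    from-to (p , vc , ex , ey) = PathsTo-≡ (joinLead-splitLead (shape p vc) vc ex ey)

HasCard-Dec : ∀ {P : Set} → Irrelevant P → (P? : Dec P) → HasCard P (if does P? then 1 else 0)
HasCard-Dec irr (yes p) = mk↔ₛ′ (λ _ → Fin.zero) (λ _ → p) (λ { Fin.zero → refl ; (Fin.suc ()) }) (irr p)
HasCard-Dec irr (no ¬p) = mk↔ₛ′ (⊥-elim ∘ ¬p) (λ ()) (λ ()) (⊥-elim ∘ ¬p)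

HasCard-⊎ : ∀ {P Q : Set} {a b} → HasCard P a → HasCard Q b → HasCard (P ⊎ Q) (a + b)
HasCard-⊎ P↔a Q↔b = ↔-trans (P↔a ⊎-cong Q↔b) (↔-sym +↔⊎)

sum3 : (Dir → ℕ) → ℕ
sum3 c = c down + (c level + c up)

Σ-Dir-↔ : ∀ {F : Dir → Set} → Σ Dir F ↔ (F down ⊎ (F level ⊎ F up))
Σ-Dir-↔ {F} = mk↔ₛ′ to from to-from from-to
  where
  to : Σ Dir F → F down ⊎ (F level ⊎ F up)
  to (down , x)  = inj₁ x
  to (level , x) = inj₂ (inj₁ x)
  to (up , x)    = inj₂ (inj₂ x)

  from : F down ⊎ (F level ⊎ F up) → Σ Dir F
  from (inj₁ x)        = down , x
  from (inj₂ (inj₁ x)) = level , x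
  from (inj₂ (inj₂ x)) = up , x

  to-from : ∀ y → to (from y) ≡ y
  to-from (inj₁ x)        = refl
  to-from (inj₂ (inj₁ x)) = refl
  to-from (inj₂ (inj₂ x)) = refl

  from-to : ∀ x → from (to x) ≡ x
  from-to (down , x)  = refl
  from-to (level , x) = refl
  from-to (up , x)    = refl

HasCard-Σ-Dir : ∀ {F : Dir → Set} {c : Dir → ℕ} → (∀ d → HasCard (F d) (c d)) → HasCard (Σ Dir F) (sum3 c)
HasCard-Σ-Dir cards = ↔-trans Σ-Dir-↔ (HasCard-⊎ (cards down) (HasCard-⊎ (cards level) (cards up)))

pathCount : ℕ → ℤ → ℕ
pathCount zero    m = sum3 λ v → if does (⟦ v ⟧ ≟ m) then 1 else 0
pathCount (suc n) m = sum3 λ v → sum3 λ h → pathCount n (m -ℤ (⟦ v ⟧ +ℤ ⟦ h ⟧))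

pathCount-HasCard : ∀ n m → HasCard (PathsTo (+ n) m) (pathCount n m)
pathCount-HasCard zero m =
  ↔-trans (PathsTo-zero-↔ m) (HasCard-Σ-Dir λ v → HasCard-Dec ℤ-≡-irrelevant (⟦ v ⟧ ≟ m))
pathCount-HasCard (suc n) m =
  ↔-trans (PathsTo-suc-↔ n m) (HasCard-Σ-Dir λ v → HasCard-Σ-Dir λ h → pathCount-HasCard n _)

pathCount-suc : ∀ n m →
  pathCount (suc n) m ≡ pathCount n (m +ℤ + 2) + 2 * pathCount n (m +ℤ + 1) + 3 * pathCount n m
                        + 2 * pathCount n (m -ℤ + 1) + pathCount n (m -ℤ + 2)
pathCount-suc n m rewrite +-identityʳ m =
  regroup (pathCount n (m +ℤ + 2)) (pathCount n (m +ℤ + 1)) (pathCount n m)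
          (pathCount n (m -ℤ + 1)) (pathCount n (m -ℤ + 2))
  where
  -- the three terms with zero shift normalise to pathCount n (m +ℤ + 0), whence the rewrite
  regroup : ∀ a b c d e → a + (b + c) + (b + (c + d) + (c + (d + e))) ≡ a + 2 * b + 3 * c + 2 * d + e
  regroup = solve-∀

pathCount-zero-outside : ∀ m → m ≢ + 0 → m ≢ + 1 → m ≢ -[1+ 0 ] → pathCount 0 m ≡ 0
pathCount-zero-outside m m≢0 m≢1 m≢-1 =
  cong₂ _+_ (indicator-≢ (m≢-1 ∘ sym)) (cong₂ _+_ (indicator-≢ (m≢0 ∘ sym)) (indicator-≢ (m≢1 ∘ sym)))
  where
  indicator-≢ : ∀ {x} → x ≢ m → (if does (x ≟ m) then 1 else 0) ≡ 0
  indicator-≢ {x} x≢m rewrite dec-false (x ≟ m) x≢m = refl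

lemma1 : Σ (ℕ → ℤ → ℕ) λ A →
             ((n : ℕ) (m : ℤ) → HasCard (PathsTo (+ n) m) (A n m))
             × (A 0 (+ 0) ≡ 1) × (A 0 (+ 1) ≡ 1) × (A 0 -[1+ 0 ] ≡ 1)
             × ((m : ℤ) → (m ≡ + 0 → ⊥) → (m ≡ + 1 → ⊥) → (m ≡ -[1+ 0 ] → ⊥) → A 0 m ≡ 0)
             × ((n : ℕ) (m : ℤ) →
                  A (suc n) m ≡ A n (m +ℤ + 2) + 2 * A n (m +ℤ + 1) + 3 * A n m
                                + 2 * A n (m -ℤ + 1) + A n (m -ℤ + 2))
lemma1 = pathCount , pathCount-HasCard , refl , refl , refl , pathCount-zero-outside , pathCount-suc
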